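{- Let $D=(d_1,\ldots,d_n)$ be a sequence of nonnegative integers (not necessarily nonincreasing) and let $d=\max(D)\geq 1$. Define $\Sigma=(\sigma_1,\ldots,\sigma_d)$ and $\Phi=(\phi_1,\ldots,\phi_d)$ from $D$ (with respect to this $d$) as in the context. Fix $k$ with $1\leq k\leq d$ and an index $r$ with $d_r=d-k+1$. Let $D'$ be obtained from $D$ by replacing $d_r$ with $d_r-1$, and let $\Sigma'=(\sigma'_1,\ldots,\sigma'_d)$ and $\Phi'=(\phi'_1,\ldots,\phi'_d)$ be defined from $D'$ by the same formulas, using the same value of $d$. For $1\leq j\leq d$ set \[\Lambda_j=\begin{cases} -\mathbf{1}_{k+\sigma_j>d} & j<k,\\ (d-k+1)-2(\sigma_k-1)+\min(\sigma_k-1,\,d-k)-\max(0,\,\sigma_{d-\sigma_k+1}-\sigma_k) & j=k,\\ 1 & j>k. \end{cases}\] Then $\sigma'_k=\sigma_k-1$ and $\sigma'_j=\sigma_j$ for all $j\neq k$, and $\phi'_j=\phi_j+\Lambda_j$ for all $1\leq j\leq d$.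
   Context: For a sequence $D=(d_1,\ldots,d_n)$ of nonnegative integers and a fixed positive integer $d$ with $d\geq\max(D)$, define for $1\leq j\leq d$: $\sigma_j=\#\{i : d_i\geq d-j+1\}$ (so $\sigma_1\leq\cdots\leq\sigma_d$, a cumulative histogram of $D$ starting from the top degree). Use the conventions $\sigma_i=0$ for $i\leq 0$ and $\sigma_i=\sigma_d$ for $i>d$. Define \[\phi_j=\sigma_j(\sigma_j-1)+\sum_{i=j+1}^{d}(\sigma_i-\sigma_{i-1})\min(\sigma_j,\,d-i+1)-\sum_{i=1}^{j}(\sigma_i-\sigma_{i-1})(d-i+1),\qquad 1\leq j\leq d,\] (the difference between the right and left sides of the Erdős–Gallai inequality at $k=\sigma_j$). Sums with starting index exceeding ending index are zero. $\mathbf{1}_P$ denotes the indicator of the condition $P$ (equal to $1$ if $P$ holds and $0$ otherwise). -}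

module Defs where

open import Data.Nat as ℕ using (ℕ; zero; suc; _≤?_; _∸_; _⊔_; _⊓_)
open import Data.Integer as ℤ using (ℤ; +_; _-_)
open import Data.Vec using (Vec; count; foldr)
open import Data.Nat.Properties using (<-cmp)
open import Data.Nat using (_<?_)
open import Relation.Binary.Definitions using (tri<; tri≈; tri>)
open import Relation.Nullary.Decidable using (Dec; yes; no)

maxD : ∀ {n} → Vec ℕ n → ℕ
maxD = foldr _ _⊔_ 0

-- σ_i for the sequence D with respect to the top degree d.
-- For 1 ≤ i ≤ d: σ_i = #{ t : d_t ≥ d - i + 1 }.
-- Conventions: σ_0 = 0, and σ_i = σ_d for i > d (threshold uses i ⊓ d).
sig : ∀ {n} → Vec ℕ n → ℕ → ℕ → ℕ
sig D d zero    = 0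
sig D d (suc i) = count (λ x → suc d ∸ (suc i ⊓ d) ≤? x) D

sigZ : ∀ {n} → Vec ℕ n → ℕ → ℕ → ℤ
sigZ D d i = + sig D d i

-- Σ_{i=a}^{b} f i  (zero when a > b)
sumFromTo : ℕ → ℕ → (ℕ → ℤ) → ℤ
sumFromTo a b f = go (suc b ∸ a)
  where
  go : ℕ → ℤ
  go zero    = + 0
  go (suc m) = f (a ℕ.+ m) ℤ.+ go m

phi : ∀ {n} → Vec ℕ n → ℕ → ℕ → ℤ
phi D d j =
  (sigZ D d j ℤ.* (sigZ D d j - + 1))
  ℤ.+ sumFromTo (suc j) d (λ i → (sigZ D d i - sigZ D d (i ∸ 1)) ℤ.* (sigZ D d j ℤ.⊓ (+ d - + i ℤ.+ + 1)))
  - sumFromTo 1 j (λ i → (sigZ D d i - sigZ D d (i ∸ 1)) ℤ.* (+ d - + i ℤ.+ + 1))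

𝟙 : ∀ {p} {P : Set p} → Dec P → ℤ
𝟙 (yes _) = + 1
𝟙 (no _)  = + 0

-- Λ_k case:  (d-k+1) - 2(σ_k - 1) + min(σ_k - 1, d-k) - max(0, σ_{d-σ_k+1} - σ_k)
-- The index d - σ_k + 1 is computed with truncated subtraction: if it is ≤ 0
-- in ℤ it becomes 0, and σ_0 = 0, matching the convention σ_i = 0 for i ≤ 0.
LambdaK : ∀ {n} → Vec ℕ n → ℕ → ℕ → ℤ
LambdaK D d k =
  ((+ d - + k ℤ.+ + 1) - + 2 ℤ.* (sigZ D d k - + 1))
  ℤ.+ ((sigZ D d k - + 1) ℤ.⊓ (+ d - + k))
  - (+ 0 ℤ.⊔ (sigZ D d (suc d ∸ sig D d k) - sigZ D d k))

Lambda : ∀ {n} → Vec ℕ n → ℕ → ℕ → ℕ → ℤ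
Lambda D d k j with <-cmp j k
... | tri< _ _ _ = ℤ.- 𝟙 (d <? k ℕ.+ sig D d j)
... | tri≈ _ _ _ = LambdaK D d k
... | tri> _ _ _ = + 1

module Submission where

-- Lowering one entry of D from d - k + 1 to d - k changes, among the counts
-- σ_i = #{t : d_t ≥ d - i + 1}, only σ_k, which drops by one.  The effect on φ is
-- then a fact about arbitrary profiles s, t : ℕ → ℕ with t = s except t_k = s_k - 1:
-- the increments Δ_i = s_i - s_{i-1} change only at i = k (by -1) and at i = k + 1
-- (by +1), so a weighted sum Σ Δ_i c_i changes by -c_k and/or +c_{k+1} according to
-- which of k, k + 1 its range contains.  For j ≠ k the cap σ_j in φ_j is unchanged:
-- for j > k the subtracted sum changes by w_{k+1} - w_k = -1, and for j < k the
-- middle sum changes by min(σ_j, d-k) - min(σ_j, d-k+1) = -1_{k+σ_j>d}.  For j = k the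
-- cap also drops, from u + 1 to u = σ_k - 1, which removes from the middle sum the
-- increments over (k, d - u]; these telescope to max(0, σ_{d-u} - σ_k).

open import Defs
open import Data.Nat using (ℕ; zero; suc; _≤_; _<_; _∸_; _+_; _⊓_; z≤n; s≤s; _≤?_; _<?_; _≟_; _≤′_; ≤′-refl; ≤′-step)
open import Data.Nat.Properties
open import Data.Integer using (ℤ; +_; _-_; -_) renaming (_+_ to _+ℤ_; _*_ to _*ℤ_; _⊓_ to _⊓ℤ_; _⊔_ to _⊔ℤ_)
import Data.Integer.Properties as ℤP
open import Data.Integer.Tactic.RingSolver using (solve-∀)
open import Data.Fin using (Fin; zero; suc)
open import Data.Vec using (Vec; []; _∷_; lookup; _[_]≔_; count)
open import Data.Product using (_×_; _,_)
open import Data.Sum using (inj₁; inj₂)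
open import Function using (_∘_)
open import Relation.Binary.Definitions using (tri<; tri≈; tri>)
open import Relation.Binary.PropositionalEquality
open import Relation.Nullary using (¬_; Dec; yes; no; contradiction)
open import Relation.Unary using (Pred; Decidable)
open ≡-Reasoning

∑ : ℕ → ℕ → (ℕ → ℤ) → ℤ
∑ a zero    f = + 0
∑ a (suc m) f = f (a + m) +ℤ ∑ a m f

sumFromTo≡∑ : ∀ a b f → sumFromTo a b f ≡ ∑ a (suc b ∸ a) f
sumFromTo≡∑ zero    zero    f = refl
sumFromTo≡∑ zero    (suc b) f = cong (f (suc b) +ℤ_) (sumFromTo≡∑ zero b f)
sumFromTo≡∑ (suc a) zero    f rewrite 0∸n≡0 a = refl
sumFromTo≡∑ (suc a) (suc b) f with a ≤? b
... | yes a≤b rewrite +-∸-assoc 1 a≤b = cong (f (suc a + (b ∸ a)) +ℤ_) (sumFromTo≡∑ (suc a) b f)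
... | no  a≰b rewrite m≤n⇒m∸n≡0 (≰⇒> a≰b) = refl

top : ∀ a m → a + m < a + suc m
top a m = +-monoʳ-< a (n<1+n m)

widen : ∀ a m {i} → i < a + m → i < a + suc m
widen a m i< = <-trans i< (top a m)

∑-cong : ∀ a m {f g : ℕ → ℤ} → (∀ i → a ≤ i → i < a + m → f i ≡ g i) → ∑ a m f ≡ ∑ a m g
∑-cong a zero    eq = refl
∑-cong a (suc m) eq =
  cong₂ _+ℤ_ (eq (a + m) (m≤m+n a m) (top a m)) (∑-cong a m (λ i p q → eq i p (widen a m q)))

∑-vanish : ∀ a m {f : ℕ → ℤ} → (∀ i → a ≤ i → i < a + m → f i ≡ + 0) → ∑ a m f ≡ + 0
∑-vanish a m zero-on = trans (∑-cong a m zero-on) (zeros m)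
  where
  zeros : ∀ m → ∑ a m (λ _ → + 0) ≡ + 0
  zeros zero    = refl
  zeros (suc m) = trans (ℤP.+-identityˡ _) (zeros m)

∑-by-difference : ∀ a m (f g : ℕ → ℤ) → ∑ a m g ≡ ∑ a m f +ℤ ∑ a m (λ i → g i - f i)
∑-by-difference a zero    f g = refl
∑-by-difference a (suc m) f g =
  trans (cong (g (a + m) +ℤ_) (∑-by-difference a m f g)) (regroup (f (a + m)) (g (a + m)) _ _)
  where
  regroup : ∀ x y F D → y +ℤ (F +ℤ D) ≡ (x +ℤ F) +ℤ ((y - x) +ℤ D)
  regroup = solve-∀

∑-single : ∀ a m {f : ℕ → ℤ} k → a ≤ k → k < a + m →
           (∀ i → a ≤ i → i < a + m → i ≢ k → f i ≡ + 0) → ∑ a m f ≡ f k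
∑-single a zero k a≤k k<a _ = contradiction (subst (k <_) (+-identityʳ a) k<a) (≤⇒≯ a≤k)
∑-single a (suc m) {f} k a≤k k< zero-off with a + m ≟ k
... | yes refl = trans (cong (f (a + m) +ℤ_) (∑-vanish a m (λ i p q → zero-off i p (widen a m q) (<⇒≢ q))))
                       (ℤP.+-identityʳ (f (a + m)))
... | no  a+m≢k = begin
  f (a + m) +ℤ ∑ a m f  ≡⟨ cong (_+ℤ ∑ a m f) (zero-off (a + m) (m≤m+n a m) (top a m) a+m≢k) ⟩
  + 0 +ℤ ∑ a m f        ≡⟨ ℤP.+-identityˡ (∑ a m f) ⟩
  ∑ a m f               ≡⟨ ∑-single a m k a≤k k<a+m (λ i p q → zero-off i p (widen a m q)) ⟩
  f k                   ∎
  where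
  k<a+m : k < a + m
  k<a+m = ≤∧≢⇒< (≤-pred (subst (k <_) (+-suc a m) k<)) (≢-sym a+m≢k)

∑-pair : ∀ a m {f : ℕ → ℤ} k → a ≤ k → suc k < a + m →
         (∀ i → a ≤ i → i < a + m → i ≢ k → i ≢ suc k → f i ≡ + 0) → ∑ a m f ≡ f (suc k) +ℤ f k
∑-pair a zero k a≤k k+1<a _ =
  contradiction (subst (suc k <_) (+-identityʳ a) k+1<a) (≤⇒≯ (≤-trans a≤k (n≤1+n k)))
∑-pair a (suc m) {f} k a≤k k+1< zero-off with a + m ≟ suc k
... | yes a+m≡k+1 =
  cong₂ _+ℤ_ (cong f a+m≡k+1)
             (∑-single a m k a≤k (subst (k <_) (sym a+m≡k+1) (n<1+n k))
                       (λ i p q i≢k → zero-off i p (widen a m q) i≢k (λ i≡k+1 → <⇒≢ q (trans i≡k+1 (sym a+m≡k+1)))))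
... | no  a+m≢k+1 = begin
  f (a + m) +ℤ ∑ a m f  ≡⟨ cong (_+ℤ ∑ a m f) (zero-off (a + m) (m≤m+n a m) (top a m) (>⇒≢ (<-trans (n<1+n k) k+1<a+m)) a+m≢k+1) ⟩
  + 0 +ℤ ∑ a m f        ≡⟨ ℤP.+-identityˡ (∑ a m f) ⟩
  ∑ a m f               ≡⟨ ∑-pair a m k a≤k k+1<a+m (λ i p q → zero-off i p (widen a m q)) ⟩
  f (suc k) +ℤ f k      ∎
  where
  k+1<a+m : suc k < a + m
  k+1<a+m = ≤∧≢⇒< (≤-pred (subst (suc k <_) (+-suc a m) k+1<)) (≢-sym a+m≢k+1)

∑-split : ∀ a m l f → ∑ a (m + l) f ≡ ∑ (a + m) l f +ℤ ∑ a m f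
∑-split a m zero    f rewrite +-identityʳ m = sym (ℤP.+-identityˡ (∑ a m f))
∑-split a m (suc l) f rewrite +-suc m l | ∑-split a m l f | sym (+-assoc a m l) =
  sym (ℤP.+-assoc (f (a + m + l)) (∑ (a + m) l f) (∑ a m f))

∑-telescope : ∀ b m (F : ℕ → ℤ) → ∑ (suc b) m (λ i → F i - F (i ∸ 1)) ≡ F (b + m) - F b
∑-telescope b zero    F rewrite +-identityʳ b = sym (ℤP.+-inverseʳ (F b))
∑-telescope b (suc m) F rewrite ∑-telescope b m F | +-suc b m = chain (F (suc (b + m))) (F (b + m)) (F b)
  where
  chain : ∀ x y z → (x - y) +ℤ (y - z) ≡ x - z
  chain = solve-∀

+-∸ : ∀ {m n} → n ≤ m → + m - + n ≡ + (m ∸ n)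
+-∸ {m} {n} n≤m = trans (ℤP.m-n≡m⊖n m n) (ℤP.⊖-≥ n≤m)

𝟙-yes : ∀ {p} {P : Set p} (P? : Dec P) → P → 𝟙 P? ≡ + 1
𝟙-yes (yes _) _ = refl
𝟙-yes (no ¬p) p = contradiction p ¬p

𝟙-no : ∀ {p} {P : Set p} (P? : Dec P) → ¬ P → 𝟙 P? ≡ + 0
𝟙-no (yes p) ¬p = contradiction p ¬p
𝟙-no (no _)  _  = refl

𝟙-cong : ∀ {p q} {P : Set p} {Q : Set q} (P? : Dec P) (Q? : Dec Q) → (P → Q) → (Q → P) → 𝟙 P? ≡ 𝟙 Q?
𝟙-cong (yes p) Q? to from = sym (𝟙-yes Q? (to p))
𝟙-cong (no ¬p) Q? to from = sym (𝟙-no Q? (λ q → ¬p (from q)))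

min-succ : ∀ a e → + (a ⊓ suc e) - + (a ⊓ e) ≡ 𝟙 (e <? a)
min-succ a e with e <? a
... | yes e<a rewrite m≥n⇒m⊓n≡n e<a | m≥n⇒m⊓n≡n (<⇒≤ e<a) = one-more (+ e)
  where
  one-more : ∀ x → (+ 1 +ℤ x) - x ≡ + 1
  one-more = solve-∀
... | no  e≮a rewrite m≤n⇒m⊓n≡m (≮⇒≥ e≮a) | m≤n⇒m⊓n≡m (m≤n⇒m≤1+n (≮⇒≥ e≮a)) = ℤP.+-inverseʳ (+ a)

weight : ℕ → ℕ → ℤ
weight d i = + d - + i +ℤ + 1

weight≡ : ∀ {d i} → i ≤ suc d → weight d i ≡ + (suc d ∸ i)
weight≡ {d} {i} i≤d+1 = trans (shuffle (+ d) (+ i)) (+-∸ i≤d+1)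
  where
  shuffle : ∀ x y → x - y +ℤ + 1 ≡ (+ 1 +ℤ x) - y
  shuffle = solve-∀

weight-step : ∀ d k → weight d (suc k) +ℤ - weight d k ≡ - + 1
weight-step d k = step (+ d) (+ k)
  where
  step : ∀ x y → (x - (+ 1 +ℤ y) +ℤ + 1) +ℤ - (x - y +ℤ + 1) ≡ - + 1
  step = solve-∀

cap : ℕ → ℕ → ℕ → ℤ
cap d x i = + x ⊓ℤ weight d i

cap-beyond : ∀ d x → cap d x (suc d) ≡ + 0
cap-beyond d x =
  trans (cong (+ x ⊓ℤ_) (trans (weight≡ {d} ≤-refl) (cong +_ (n∸n≡0 d)))) (cong +_ (⊓-zeroʳ x))

cap-step : ∀ d a k → k ≤ d → cap d a (suc k) +ℤ - cap d a k ≡ - 𝟙 (d <? k + a)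
cap-step d a k k≤d = begin
  cap d a (suc k) +ℤ - cap d a k
    ≡⟨ cong₂ (λ x y → + a ⊓ℤ x - + a ⊓ℤ y) (weight≡ (s≤s k≤d))
             (trans (weight≡ (m≤n⇒m≤1+n k≤d)) (cong +_ (+-∸-assoc 1 k≤d))) ⟩
  + (a ⊓ e) - + (a ⊓ suc e)
    ≡⟨ flip (+ (a ⊓ suc e)) (+ (a ⊓ e)) ⟩
  - (+ (a ⊓ suc e) - + (a ⊓ e))
    ≡⟨ cong -_ (trans (min-succ a e) (𝟙-cong (e <? a) (d <? k + a) to from)) ⟩
  - 𝟙 (d <? k + a) ∎
  where
  e : ℕ
  e = d ∸ k
  flip : ∀ x y → y - x ≡ - (x - y)
  flip = solve-∀
  to : e < a → d < k + a
  to e<a = subst (_< k + a) (m+[n∸m]≡n k≤d) (+-monoʳ-< k e<a)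
  from : d < k + a → e < a
  from d<k+a = +-cancelˡ-< k e a (subst (_< k + a) (sym (m+[n∸m]≡n k≤d)) d<k+a)

cap-raise : ∀ d u i → 1 ≤ i → i ≤ d → cap d (suc u) i - cap d u i ≡ 𝟙 (i ≤? d ∸ u)
cap-raise d u i 1≤i i≤d = begin
  cap d (suc u) i - cap d u i
    ≡⟨ cong (λ w → + suc u ⊓ℤ w - + u ⊓ℤ w) (weight≡ (m≤n⇒m≤1+n i≤d)) ⟩
  + (suc u ⊓ e) - + (u ⊓ e)
    ≡⟨ cong₂ (λ x y → + x - + y) (⊓-comm (suc u) e) (⊓-comm u e) ⟩
  + (e ⊓ suc u) - + (e ⊓ u)
    ≡⟨ min-succ e u ⟩
  𝟙 (u <? e)
    ≡⟨ 𝟙-cong (u <? e) (i ≤? d ∸ u) to from ⟩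
  𝟙 (i ≤? d ∸ u) ∎
  where
  e : ℕ
  e = suc d ∸ i
  to : u < e → i ≤ d ∸ u
  to u<e = m+n≤o⇒m≤o∸n i (subst (_≤ d) (+-comm u i) (≤-pred (m≤o∸n⇒m+n≤o (suc u) (m≤n⇒m≤1+n i≤d) u<e)))
  from : i ≤ d ∸ u → u < e
  from i≤d-u = m+n≤o⇒m≤o∸n (suc u) (s≤s (subst (_≤ d) (+-comm i u) (m≤o∸n⇒m+n≤o i u≤d i≤d-u)))
    where
    u≤d : u ≤ d
    u≤d = <⇒≤ (∸-cancelʳ-< (subst (_< d ∸ u) (sym (n∸n≡0 d)) (≤-trans 1≤i i≤d-u)))

max0-≥ : ∀ {m n} → n ≤ m → + 0 ⊔ℤ (+ m - + n) ≡ + m - + n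
max0-≥ n≤m rewrite +-∸ n≤m = refl

max0-≤ : ∀ {m n} → m ≤ n → + 0 ⊔ℤ (+ m - + n) ≡ + 0
max0-≤ {m} {n} m≤n rewrite ℤP.m-n≡m⊖n m n | ℤP.⊖-≤ m≤n with n ∸ m
... | zero  = refl
... | suc _ = refl

Δ : (ℕ → ℕ) → ℕ → ℤ
Δ s i = + s i - + s (i ∸ 1)

Φ : (ℕ → ℕ) → ℕ → ℕ → ℤ
Φ s d j = + s j *ℤ (+ s j - + 1)
        +ℤ ∑ (suc j) (d ∸ j) (λ i → Δ s i *ℤ cap d (s j) i)
        - ∑ 1 j (λ i → Δ s i *ℤ weight d i)

phi≡Φ : ∀ {n} (D : Vec ℕ n) d j → phi D d j ≡ Φ (sig D d) d j
phi≡Φ D d j = cong₂ (λ B C → + sig D d j *ℤ (+ sig D d j - + 1) +ℤ B - C)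
                    (sumFromTo≡∑ (suc j) d _) (sumFromTo≡∑ 1 j _)

ΛK : (ℕ → ℕ) → ℕ → ℕ → ℤ
ΛK s d k = ((weight d k - + 2 *ℤ (+ s k - + 1)) +ℤ ((+ s k - + 1) ⊓ℤ (+ d - + k)))
         - (+ 0 ⊔ℤ (+ s (suc d ∸ s k) - + s k))

mono-≤ : ∀ (s : ℕ → ℕ) → (∀ i → s i ≤ s (suc i)) → ∀ {i j} → i ≤ j → s i ≤ s j
mono-≤ s step i≤j = go (≤⇒≤′ i≤j)
  where
  go : ∀ {i j} → i ≤′ j → s i ≤ s j
  go ≤′-refl     = ≤-refl
  go (≤′-step p) = ≤-trans (go p) (step _)

in-tail : ∀ {j d i} → j ≤ d → i < suc j + (d ∸ j) → i ≤ d
in-tail j≤d i< = ≤-trans (≤-pred i<) (≤-reflexive (m+[n∸m]≡n j≤d))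

to-tail : ∀ {j d i} → j ≤ d → i ≤ d → i < suc j + (d ∸ j)
to-tail j≤d i≤d = s≤s (≤-trans i≤d (≤-reflexive (sym (m+[n∸m]≡n j≤d))))

capped-telescope : ∀ (s : ℕ → ℕ) → (∀ i → s i ≤ s (suc i)) → ∀ {k d T} → k ≤ d → T ≤ d →
                   ∑ (suc k) (d ∸ k) (λ i → 𝟙 (i ≤? T) *ℤ Δ s i) ≡ + 0 ⊔ℤ (+ s T - + s k)
capped-telescope s step {k} {d} {T} k≤d T≤d with T ≤? k
... | yes T≤k =
  trans (∑-vanish (suc k) (d ∸ k) (λ i k<i _ → cong (_*ℤ Δ s i) (𝟙-no (i ≤? T) (<⇒≱ (≤-<-trans T≤k k<i)))))
        (sym (max0-≤ (mono-≤ s step T≤k)))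
... | no  T≰k = begin
  ∑ (suc k) (d ∸ k) f                                  ≡⟨ cong (λ m → ∑ (suc k) m f) lengths ⟩
  ∑ (suc k) ((T ∸ k) + (d ∸ T)) f                      ≡⟨ ∑-split (suc k) (T ∸ k) (d ∸ T) f ⟩
  ∑ (suc k + (T ∸ k)) (d ∸ T) f +ℤ ∑ (suc k) (T ∸ k) f ≡⟨ cong₂ _+ℤ_ beyond-T up-to-T ⟩
  + 0 +ℤ (+ s T - + s k)                               ≡⟨ ℤP.+-identityˡ _ ⟩
  + s T - + s k                                        ≡⟨ sym (max0-≥ (mono-≤ s step (<⇒≤ (≰⇒> T≰k)))) ⟩
  + 0 ⊔ℤ (+ s T - + s k)                               ∎
  where
  f : ℕ → ℤ
  f i = 𝟙 (i ≤? T) *ℤ Δ s i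
  k+[T∸k] : k + (T ∸ k) ≡ T
  k+[T∸k] = m+[n∸m]≡n (<⇒≤ (≰⇒> T≰k))
  lengths : d ∸ k ≡ (T ∸ k) + (d ∸ T)
  lengths = begin
    d ∸ k                   ≡⟨ cong (_∸ k) (sym (trans (sym (+-assoc k (T ∸ k) (d ∸ T)))
                                                       (trans (cong (_+ (d ∸ T)) k+[T∸k]) (m+[n∸m]≡n T≤d)))) ⟩
    k + ((T ∸ k) + (d ∸ T)) ∸ k ≡⟨ m+n∸m≡n k _ ⟩
    (T ∸ k) + (d ∸ T)        ∎
  beyond-T : ∑ (suc k + (T ∸ k)) (d ∸ T) f ≡ + 0
  beyond-T = ∑-vanish (suc k + (T ∸ k)) (d ∸ T) (λ i T<i _ →
    cong (_*ℤ Δ s i) (𝟙-no (i ≤? T) (<⇒≱ (subst (_≤ i) (cong suc k+[T∸k]) T<i))))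
  up-to-T : ∑ (suc k) (T ∸ k) f ≡ + s T - + s k
  up-to-T = begin
    ∑ (suc k) (T ∸ k) f           ≡⟨ ∑-cong (suc k) (T ∸ k) (λ i _ i< →
                                       trans (cong (_*ℤ Δ s i) (𝟙-yes (i ≤? T) (subst (i ≤_) k+[T∸k] (≤-pred i<))))
                                             (ℤP.*-identityˡ (Δ s i))) ⟩
    ∑ (suc k) (T ∸ k) (Δ s)       ≡⟨ ∑-telescope k (T ∸ k) (λ i → + s i) ⟩
    + s (k + (T ∸ k)) - + s k     ≡⟨ cong (λ x → + s x - + s k) k+[T∸k] ⟩
    + s T - + s k                 ∎

shift-parts : ∀ A {B B′ C C′} β γ → B′ ≡ B +ℤ β → C′ ≡ C +ℤ γ → A +ℤ B′ - C′ ≡ (A +ℤ B - C) +ℤ (β - γ)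
shift-parts A {B} {C = C} β γ refl refl = regroup A B C β γ
  where
  regroup : ∀ A B C β γ → A +ℤ (B +ℤ β) - (C +ℤ γ) ≡ (A +ℤ B - C) +ℤ (β - γ)
  regroup = solve-∀

module Perturbation (s t : ℕ → ℕ) (d k : ℕ) (1≤k : 1 ≤ k) (k≤d : k ≤ d)
                    (agree : ∀ i → i ≤ d → i ≢ k → t i ≡ s i) (drop : s k ≡ suc (t k)) where

  Δ-away : ∀ i → 1 ≤ i → i ≤ d → i ≢ k → i ≢ suc k → Δ t i ≡ Δ s i
  Δ-away (suc i) _ i<d i+1≢k i+1≢k+1 =
    cong₂ (λ x y → + x - + y) (agree (suc i) i<d i+1≢k)
                              (agree i (≤-trans (n≤1+n i) i<d) (λ i≡k → i+1≢k+1 (cong suc i≡k)))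

  Δ-at : Δ t k ≡ Δ s k - + 1
  Δ-at = begin
    + t k - + t (k ∸ 1)               ≡⟨ cong (λ x → + t k - + x) (agree (k ∸ 1) (≤-trans (m∸n≤m k 1) k≤d) k-1≢k) ⟩
    + t k - + s (k ∸ 1)               ≡⟨ lower (+ t k) (+ s (k ∸ 1)) ⟩
    + suc (t k) - + s (k ∸ 1) - + 1   ≡⟨ cong (λ x → + x - + s (k ∸ 1) - + 1) (sym drop) ⟩
    Δ s k - + 1                       ∎
    where
    k-1≢k : k ∸ 1 ≢ k
    k-1≢k = <⇒≢ (∸-monoʳ-< {k} {1} {0} (s≤s z≤n) 1≤k)
    lower : ∀ x y → x - y ≡ (+ 1 +ℤ x) - y - + 1
    lower = solve-∀

  Δ-after : k < d → Δ t (suc k) ≡ Δ s (suc k) +ℤ + 1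
  Δ-after k<d = begin
    + t (suc k) - + t k               ≡⟨ cong (λ x → + x - + t k) (agree (suc k) k<d (>⇒≢ (n<1+n k))) ⟩
    + s (suc k) - + t k               ≡⟨ raise (+ s (suc k)) (+ t k) ⟩
    + s (suc k) - + suc (t k) +ℤ + 1  ≡⟨ cong (λ x → + s (suc k) - + x +ℤ + 1) (sym drop) ⟩
    Δ s (suc k) +ℤ + 1                ∎
    where
    raise : ∀ x y → x - y ≡ x - (+ 1 +ℤ y) +ℤ + 1
    raise = solve-∀

  jump : (ℕ → ℤ) → ℕ → ℤ
  jump c i = Δ t i *ℤ c i - Δ s i *ℤ c i

  jump-away : ∀ c i → 1 ≤ i → i ≤ d → i ≢ k → i ≢ suc k → jump c i ≡ + 0
  jump-away c i 1≤i i≤d i≢k i≢k+1 =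
    trans (cong (λ x → x *ℤ c i - Δ s i *ℤ c i) (Δ-away i 1≤i i≤d i≢k i≢k+1)) (ℤP.+-inverseʳ (Δ s i *ℤ c i))

  jump-at : ∀ c → jump c k ≡ - c k
  jump-at c = trans (cong (λ x → x *ℤ c k - Δ s k *ℤ c k) Δ-at) (lose (Δ s k) (c k))
    where
    lose : ∀ x y → (x - + 1) *ℤ y - x *ℤ y ≡ - y
    lose = solve-∀

  jump-after : ∀ c → k < d → jump c (suc k) ≡ c (suc k)
  jump-after c k<d =
    trans (cong (λ x → x *ℤ c (suc k) - Δ s (suc k) *ℤ c (suc k)) (Δ-after k<d)) (gain (Δ s (suc k)) (c (suc k)))
    where
    gain : ∀ x y → (x +ℤ + 1) *ℤ y - x *ℤ y ≡ y
    gain = solve-∀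

  -- Ranges ending at d may omit
  -- k + 1 = d + 1, which is harmless when c vanishes there.
  jumps-head-below : ∀ c j → j < k → ∑ 1 j (jump c) ≡ + 0
  jumps-head-below c j j<k = ∑-vanish 1 j (λ i 1≤i i≤j →
    let i<k = ≤-<-trans (≤-pred i≤j) j<k in
    jump-away c i 1≤i (≤-trans (<⇒≤ i<k) k≤d) (<⇒≢ i<k) (<⇒≢ (<-trans i<k (n<1+n k))))

  jumps-head-to : ∀ c → ∑ 1 k (jump c) ≡ - c k
  jumps-head-to c = trans (∑-single 1 k k 1≤k (n<1+n k) (λ i 1≤i i≤k i≢k →
                            jump-away c i 1≤i (≤-trans (≤-pred i≤k) k≤d) i≢k (<⇒≢ i≤k)))
                          (jump-at c)

  jumps-head-past : ∀ c j → k < j → j ≤ d → ∑ 1 j (jump c) ≡ c (suc k) +ℤ - c k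
  jumps-head-past c j k<j j≤d =
    trans (∑-pair 1 j k 1≤k (s≤s k<j) (λ i 1≤i i≤j → jump-away c i 1≤i (≤-trans (≤-pred i≤j) j≤d)))
          (cong₂ _+ℤ_ (jump-after c (<-≤-trans k<j j≤d)) (jump-at c))

  jumps-tail-above : ∀ c j → k < j → j ≤ d → ∑ (suc j) (d ∸ j) (jump c) ≡ + 0
  jumps-tail-above c j k<j j≤d = ∑-vanish (suc j) (d ∸ j) (λ i j<i i< →
    jump-away c i (≤-trans (s≤s z≤n) j<i) (in-tail j≤d i<) (>⇒≢ (<-trans k<j j<i)) (>⇒≢ (<-≤-trans (s≤s k<j) j<i)))

  jumps-tail-below : ∀ c j → j < k → c (suc d) ≡ + 0 → ∑ (suc j) (d ∸ j) (jump c) ≡ c (suc k) +ℤ - c k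
  jumps-tail-below c j j<k c-beyond with m≤n⇒m<n∨m≡n k≤d
  ... | inj₁ k<d =
    trans (∑-pair (suc j) (d ∸ j) k j<k (to-tail j≤d k<d) (λ i j<i i< → jump-away c i (≤-trans (s≤s z≤n) j<i) (in-tail j≤d i<)))
          (cong₂ _+ℤ_ (jump-after c k<d) (jump-at c))
    where
    j≤d : j ≤ d
    j≤d = ≤-trans (<⇒≤ j<k) k≤d
  ... | inj₂ k≡d = begin
    ∑ (suc j) (d ∸ j) (jump c)  ≡⟨ ∑-single (suc j) (d ∸ j) k j<k (to-tail j≤d k≤d) (λ i j<i i< i≢k →
                                     jump-away c i (≤-trans (s≤s z≤n) j<i) (in-tail j≤d i<) i≢k
                                               (<⇒≢ (s≤s (≤-trans (in-tail j≤d i<) (≤-reflexive (sym k≡d)))))) ⟩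
    jump c k                    ≡⟨ jump-at c ⟩
    - c k                       ≡⟨ sym (ℤP.+-identityˡ (- c k)) ⟩
    + 0 +ℤ - c k                ≡⟨ cong (λ x → x +ℤ - c k) (sym (trans (cong (c ∘ suc) k≡d) c-beyond)) ⟩
    c (suc k) +ℤ - c k          ∎
    where
    j≤d : j ≤ d
    j≤d = ≤-trans (<⇒≤ j<k) k≤d

  jumps-tail-after : ∀ c → c (suc d) ≡ + 0 → ∑ (suc k) (d ∸ k) (jump c) ≡ c (suc k)
  jumps-tail-after c c-beyond with m≤n⇒m<n∨m≡n k≤d
  ... | inj₁ k<d =
    trans (∑-single (suc k) (d ∸ k) (suc k) ≤-refl (to-tail k≤d k<d) (λ i k<i i< →
             jump-away c i (≤-trans (s≤s z≤n) k<i) (in-tail k≤d i<) (>⇒≢ k<i)))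
          (jump-after c k<d)
  ... | inj₂ k≡d =
    trans (∑-vanish (suc k) (d ∸ k) (λ i k<i i< → contradiction (≤-trans (in-tail k≤d i<) (≤-reflexive (sym k≡d))) (<⇒≱ k<i)))
          (sym (trans (cong (c ∘ suc) k≡d) c-beyond))

  Φ-away : ∀ j → j ≤ d → j ≢ k →
           Φ t d j ≡ + s j *ℤ (+ s j - + 1) +ℤ ∑ (suc j) (d ∸ j) (λ i → Δ t i *ℤ cap d (s j) i)
                                            - ∑ 1 j (λ i → Δ t i *ℤ weight d i)
  Φ-away j j≤d j≢k =
    cong (λ x → + x *ℤ (+ x - + 1) +ℤ ∑ (suc j) (d ∸ j) (λ i → Δ t i *ℤ cap d x i) - ∑ 1 j (λ i → Δ t i *ℤ weight d i))
         (agree j j≤d j≢k)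

  ∑-jumps : ∀ a m c → ∑ a m (λ i → Δ t i *ℤ c i) ≡ ∑ a m (λ i → Δ s i *ℤ c i) +ℤ ∑ a m (jump c)
  ∑-jumps a m c = ∑-by-difference a m (λ i → Δ s i *ℤ c i) (λ i → Δ t i *ℤ c i)

  -- j > k: the subtracted sum sees both changes, weighted w_{k+1} - w_k = -1.
  φ-above : ∀ j → k < j → j ≤ d → Φ t d j ≡ Φ s d j +ℤ + 1
  φ-above j k<j j≤d = trans (Φ-away j j≤d (>⇒≢ k<j)) (shift-parts (+ s j *ℤ (+ s j - + 1)) (+ 0) (- + 1) middle subtracted)
    where
    Bₛ Cₛ : ℤ
    Bₛ = ∑ (suc j) (d ∸ j) (λ i → Δ s i *ℤ cap d (s j) i)
    Cₛ = ∑ 1 j (λ i → Δ s i *ℤ weight d i)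
    middle : ∑ (suc j) (d ∸ j) (λ i → Δ t i *ℤ cap d (s j) i) ≡ Bₛ +ℤ + 0
    middle = trans (∑-jumps (suc j) (d ∸ j) (cap d (s j))) (cong (Bₛ +ℤ_) (jumps-tail-above (cap d (s j)) j k<j j≤d))
    subtracted : ∑ 1 j (λ i → Δ t i *ℤ weight d i) ≡ Cₛ +ℤ - + 1
    subtracted = trans (∑-jumps 1 j (weight d))
                       (cong (Cₛ +ℤ_) (trans (jumps-head-past (weight d) j k<j j≤d) (weight-step d k)))

  -- j < k: the middle sum sees both changes, weighted min(s_j, d - k) - min(s_j, d - k + 1).
  φ-below : ∀ j → j < k → Φ t d j ≡ Φ s d j +ℤ - 𝟙 (d <? k + s j)
  φ-below j j<k =
    trans (Φ-away j (≤-trans (<⇒≤ j<k) k≤d) (<⇒≢ j<k))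
          (trans (shift-parts (+ s j *ℤ (+ s j - + 1)) (- 𝟙 (d <? k + s j)) (+ 0) middle subtracted)
                 (cong (Φ s d j +ℤ_) (ℤP.+-identityʳ _)))
    where
    Bₛ Cₛ : ℤ
    Bₛ = ∑ (suc j) (d ∸ j) (λ i → Δ s i *ℤ cap d (s j) i)
    Cₛ = ∑ 1 j (λ i → Δ s i *ℤ weight d i)
    middle : ∑ (suc j) (d ∸ j) (λ i → Δ t i *ℤ cap d (s j) i)
             ≡ Bₛ +ℤ - 𝟙 (d <? k + s j)
    middle = trans (∑-jumps (suc j) (d ∸ j) (cap d (s j)))
                   (cong (Bₛ +ℤ_) (trans (jumps-tail-below (cap d (s j)) j j<k (cap-beyond d (s j)))
                                        (cap-step d (s j) k k≤d)))
    subtracted : ∑ 1 j (λ i → Δ t i *ℤ weight d i) ≡ Cₛ +ℤ + 0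
    subtracted = trans (∑-jumps 1 j (weight d)) (cong (Cₛ +ℤ_) (jumps-head-below (weight d) j j<k))

  -- j = k: besides the jumps, the cap of the middle sum drops from s_k = u + 1 to u, which
  -- removes the increments of s over (k, d - u]: max(0, s_{d-u} - s_k) by capped-telescope.
  φ-at : (∀ i → s i ≤ s (suc i)) → Φ t d k ≡ Φ s d k +ℤ ΛK s d k
  φ-at step = begin
    Φ t d k
      ≡⟨ cong₂ (λ B C′ → + u *ℤ (+ u - + 1) +ℤ B - C′) middle subtracted ⟩
    + u *ℤ (+ u - + 1) +ℤ (Bᵤ +ℤ M) - (C +ℤ - W)
      ≡⟨ regroup (+ u) Bᵤ C X M W ⟩
    (+ suc u *ℤ (+ suc u - + 1) +ℤ (Bᵤ +ℤ X) - C) +ℤ ((W - + 2 *ℤ (+ suc u - + 1)) +ℤ M - X)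
      ≡⟨ cong₂ (λ B m → (+ suc u *ℤ (+ suc u - + 1) +ℤ B - C) +ℤ ((W - + 2 *ℤ (+ suc u - + 1)) +ℤ m - X))
               (sym recap) M≡ ⟩
    F (suc u)
      ≡⟨ cong F (sym drop) ⟩
    Φ s d k +ℤ ΛK s d k ∎
    where
    u : ℕ
    u = t k
    W C M X Bᵤ : ℤ
    W  = weight d k
    C  = ∑ 1 k (λ i → Δ s i *ℤ weight d i)
    M  = cap d u (suc k)
    X  = + 0 ⊔ℤ (+ s (d ∸ u) - + s k)
    Bᵤ = ∑ (suc k) (d ∸ k) (λ i → Δ s i *ℤ cap d u i)
    -- Φ s d k +ℤ ΛK s d k with the occurrences of s_k that are replaced by u + 1.
    F : ℕ → ℤ
    F x = (+ x *ℤ (+ x - + 1) +ℤ ∑ (suc k) (d ∸ k) (λ i → Δ s i *ℤ cap d x i) - C)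
          +ℤ (((W - + 2 *ℤ (+ x - + 1)) +ℤ ((+ x - + 1) ⊓ℤ (+ d - + k))) - (+ 0 ⊔ℤ (+ s (suc d ∸ x) - + s k)))
    middle : ∑ (suc k) (d ∸ k) (λ i → Δ t i *ℤ cap d u i) ≡ Bᵤ +ℤ M
    middle = trans (∑-jumps (suc k) (d ∸ k) (cap d u)) (cong (Bᵤ +ℤ_) (jumps-tail-after (cap d u) (cap-beyond d u)))
    subtracted : ∑ 1 k (λ i → Δ t i *ℤ weight d i) ≡ C +ℤ - W
    subtracted = trans (∑-jumps 1 k (weight d)) (cong (C +ℤ_) (jumps-head-to (weight d)))
    recap : ∑ (suc k) (d ∸ k) (λ i → Δ s i *ℤ cap d (suc u) i) ≡ Bᵤ +ℤ X
    recap = trans (∑-by-difference (suc k) (d ∸ k) _ _)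
                  (cong (Bᵤ +ℤ_) (trans (∑-cong (suc k) (d ∸ k) raised)
                                        (capped-telescope s step k≤d (m∸n≤m d u))))
      where
      factor : ∀ δ a b → δ *ℤ a - δ *ℤ b ≡ (a - b) *ℤ δ
      factor = solve-∀
      raised : ∀ i → suc k ≤ i → i < suc k + (d ∸ k) →
               Δ s i *ℤ cap d (suc u) i - Δ s i *ℤ cap d u i ≡ 𝟙 (i ≤? d ∸ u) *ℤ Δ s i
      raised i k<i i< = trans (factor (Δ s i) _ _)
                              (cong (_*ℤ Δ s i) (cap-raise d u i (≤-trans (s≤s z≤n) k<i) (in-tail k≤d i<)))
    M≡ : M ≡ (+ suc u - + 1) ⊓ℤ (+ d - + k)
    M≡ = cong₂ _⊓ℤ_ (dec (+ u)) (shift (+ d) (+ k))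
      where
      dec : ∀ x → x ≡ (+ 1 +ℤ x) - + 1
      dec = solve-∀
      shift : ∀ x y → x - (+ 1 +ℤ y) +ℤ + 1 ≡ x - y
      shift = solve-∀
    regroup : ∀ U B C X M W → U *ℤ (U - + 1) +ℤ (B +ℤ M) - (C +ℤ - W)
                            ≡ ((+ 1 +ℤ U) *ℤ ((+ 1 +ℤ U) - + 1) +ℤ (B +ℤ X) - C) +ℤ ((W - + 2 *ℤ ((+ 1 +ℤ U) - + 1)) +ℤ M - X)
    regroup = solve-∀

above : ∀ {n} → ℕ → Vec ℕ n → ℕ
above θ D = count (θ ≤?_) D

count-≔-same : ∀ {a p} {A : Set a} {P : Pred A p} (P? : Decidable P) {n} (D : Vec A n) r v →
               (P (lookup D r) → P v) → (P v → P (lookup D r)) → count P? (D [ r ]≔ v) ≡ count P? D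
count-≔-same P? (x ∷ D) zero v to from with P? x | P? v
... | yes _  | yes _  = refl
... | no  _  | no  _  = refl
... | yes p  | no ¬q  = contradiction (to p) ¬q
... | no  ¬p | yes q  = contradiction (from q) ¬p
count-≔-same P? (x ∷ D) (suc r) v to from with P? x
... | yes _ = cong suc (count-≔-same P? D r v to from)
... | no  _ = count-≔-same P? D r v to from

count-≔-drop : ∀ {a p} {A : Set a} {P : Pred A p} (P? : Decidable P) {n} (D : Vec A n) r v →
               P (lookup D r) → ¬ P v → count P? D ≡ suc (count P? (D [ r ]≔ v))
count-≔-drop P? (x ∷ D) zero v p ¬q with P? x | P? v
... | yes _  | no _  = refl
... | yes _  | yes q = contradiction q ¬q
... | no ¬p  | _     = contradiction p ¬p
count-≔-drop P? (x ∷ D) (suc r) v p ¬q with P? x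
... | yes _ = cong suc (count-≔-drop P? D r v p ¬q)
... | no  _ = count-≔-drop P? D r v p ¬q

count-mono : ∀ {a p q} {A : Set a} {P : Pred A p} {Q : Pred A q} (P? : Decidable P) (Q? : Decidable Q) →
             (∀ {x} → P x → Q x) → ∀ {n} (D : Vec A n) → count P? D ≤ count Q? D
count-mono P? Q? P⇒Q []      = z≤n
count-mono P? Q? P⇒Q (x ∷ D) with P? x | Q? x
... | yes _ | yes _  = s≤s (count-mono P? Q? P⇒Q D)
... | yes p | no ¬q  = contradiction (P⇒Q p) ¬q
... | no _  | yes _  = m≤n⇒m≤1+n (count-mono P? Q? P⇒Q D)
... | no _  | no _   = count-mono P? Q? P⇒Q D

sig≡above : ∀ {n} (D : Vec ℕ n) {d i} → 1 ≤ i → i ≤ d → sig D d i ≡ above (suc d ∸ i) D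
sig≡above D {d} {suc i} _ i<d = cong (λ m → above (suc d ∸ m) D) (m≤n⇒m⊓n≡m i<d)

sig-step : ∀ {n} (D : Vec ℕ n) d i → sig D d i ≤ sig D d (suc i)
sig-step D d zero    = z≤n
sig-step D d (suc i) = count-mono _ _ (≤-trans (∸-monoʳ-≤ (suc d) (⊓-monoˡ-≤ d (n≤1+n (suc i))))) D

module Update {n} (D : Vec ℕ n) (r : Fin n) {d k : ℕ} (1≤k : 1 ≤ k) (k≤d : k ≤ d)
              (entry : lookup D r ≡ d ∸ k + 1) where

  D′ : Vec ℕ n
  D′ = D [ r ]≔ (lookup D r ∸ 1)

  old : lookup D r ≡ suc d ∸ k
  old = trans entry (trans (+-comm (d ∸ k) 1) (sym (+-∸-assoc 1 k≤d)))

  new : lookup D r ∸ 1 ≡ suc d ∸ suc k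
  new = trans (cong (_∸ 1) entry) (m+n∸n≡m (d ∸ k) 1)

  old-reaches : ∀ {i} → k ≤ i → suc d ∸ i ≤ lookup D r
  old-reaches {i} k≤i = subst (suc d ∸ i ≤_) (sym old) (∸-monoʳ-≤ (suc d) k≤i)

  reaches-old : ∀ {i} → suc d ∸ i ≤ lookup D r → k ≤ i
  reaches-old {i} reach = ∸-cancelʳ-≤ (m≤n⇒m≤1+n k≤d) (subst (suc d ∸ i ≤_) old reach)

  new-reaches : ∀ {i} → k < i → suc d ∸ i ≤ lookup D r ∸ 1
  new-reaches {i} k<i = subst (suc d ∸ i ≤_) (sym new) (∸-monoʳ-≤ (suc d) k<i)

  reaches-new : ∀ {i} → suc d ∸ i ≤ lookup D r ∸ 1 → k < i
  reaches-new {i} reach = ∸-cancelʳ-≤ (s≤s k≤d) (subst (suc d ∸ i ≤_) new reach)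

  σ-unchanged : ∀ i → i ≤ d → i ≢ k → sig D′ d i ≡ sig D d i
  σ-unchanged zero    _   _   = refl
  σ-unchanged (suc i) i<d i≢k = begin
    sig D′ d (suc i)         ≡⟨ sig≡above D′ (s≤s z≤n) i<d ⟩
    above (suc d ∸ suc i) D′ ≡⟨ count-≔-same _ D r _ (λ reach → new-reaches (≤∧≢⇒< (reaches-old {suc i} reach) (≢-sym i≢k)))
                                                      (λ reach → old-reaches (<⇒≤ (reaches-new {suc i} reach))) ⟩
    above (suc d ∸ suc i) D  ≡⟨ sym (sig≡above D (s≤s z≤n) i<d) ⟩
    sig D d (suc i)          ∎

  σ-drops : sig D d k ≡ suc (sig D′ d k)
  σ-drops = begin
    sig D d k                   ≡⟨ sig≡above D 1≤k k≤d ⟩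
    above (suc d ∸ k) D         ≡⟨ count-≔-drop _ D r _ (old-reaches ≤-refl) (λ reach → <-irrefl refl (reaches-new reach)) ⟩
    suc (above (suc d ∸ k) D′)  ≡⟨ cong suc (sym (sig≡above D′ 1≤k k≤d)) ⟩
    suc (sig D′ d k)            ∎

lemma2 : (n : ℕ) (D : Vec ℕ n) → 1 ≤ maxD D →
    (k : ℕ) → 1 ≤ k → k ≤ maxD D →
    (r : Fin n) → lookup D r ≡ maxD D ∸ k + 1 →
      (sigZ (D [ r ]≔ (lookup D r ∸ 1)) (maxD D) k ≡ sigZ D (maxD D) k - + 1)
      × ((j : ℕ) → 1 ≤ j → j ≤ maxD D → j ≢ k →
           sig (D [ r ]≔ (lookup D r ∸ 1)) (maxD D) j ≡ sig D (maxD D) j)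
      × ((j : ℕ) → 1 ≤ j → j ≤ maxD D →
           phi (D [ r ]≔ (lookup D r ∸ 1)) (maxD D) j ≡ phi D (maxD D) j +ℤ Lambda D (maxD D) k j)
lemma2 n D _ k 1≤k k≤d r entry = σ-at-k , (λ j _ → σ-unchanged j) , φ-change
  where
  d : ℕ
  d = maxD D
  open Update D r 1≤k k≤d entry
  open Perturbation (sig D d) (sig D′ d) d k 1≤k k≤d σ-unchanged σ-drops

  σ-at-k : sigZ D′ d k ≡ sigZ D d k - + 1
  σ-at-k = trans (dec (+ sig D′ d k)) (cong (λ x → + x - + 1) (sym σ-drops))
    where
    dec : ∀ x → x ≡ (+ 1 +ℤ x) - + 1
    dec = solve-∀

  Φ-change : ∀ j → j ≤ d → Φ (sig D′ d) d j ≡ Φ (sig D d) d j +ℤ Lambda D d k j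
  Φ-change j j≤d with <-cmp j k
  ... | tri< j<k _ _ = φ-below j j<k
  ... | tri≈ _ refl _ = φ-at (sig-step D d)
  ... | tri> _ _ k<j = φ-above j k<j j≤d

  φ-change : ∀ j → 1 ≤ j → j ≤ d → phi D′ d j ≡ phi D d j +ℤ Lambda D d k j
  φ-change j _ j≤d = trans (phi≡Φ D′ d j) (trans (Φ-change j j≤d) (cong (_+ℤ Lambda D d k j) (sym (phi≡Φ D d j))))
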